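{- Let $\Gamma\ge 1$ and $\beta$ be positive integers and let $\alpha=\max\big(2^{12}, \lceil 136\ln(16\Gamma)\rceil\big)$. Let $\mathcal{H}=(V,\mathcal{E})$ be a finite hypergraph such that (i) every hyperedge intersects at most $\Gamma$ other hyperedges, and (ii) every hyperedge $E\in\mathcal{E}$ satisfies $\alpha\le |E|\le\beta$. Then $ch_{CF}(\mathcal{H})\le 32\beta$.
   Context: For a hypergraph $\mathcal{H}=(V,\mathcal{E})$, a $k$-assignment $\mathcal{L}=\{L_v: v\in V\}$ assigns to each vertex a set $L_v$ of exactly $k$ admissible colors. An $\mathcal{L}$-CF-coloring is a map $f$ on $V$ with $f(v)\in L_v$ for all $v$ such that every hyperedge $E$ contains a vertex whose color differs from the color of every other vertex of $E$. $ch_{CF}(\mathcal{H})$ is the minimum $k$ such that $\mathcal{H}$ admits an $\mathcal{L}$-CF-coloring for every $k$-assignment $\mathcal{L}$. $\ln$ is the natural logarithm. -}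

module Defs where

open import Data.Nat using (ℕ; zero; suc; _+_; _*_; _^_; _≤_; _!)
open import Data.Fin using (Fin)
open import Data.Fin.Properties using (_≟_)
open import Data.Fin.Subset using (Subset; _∈_; _∩_; ∣_∣)
open import Data.Fin.Subset.Properties using (nonempty?)
open import Data.Vec using (tabulate)
open import Data.Bool using (Bool; true; false; if_then_else_)
open import Data.Product using (Σ; ∃; _×_)
open import Data.List using (List; length)
open import Data.List.Membership.Propositional using () renaming (_∈_ to _∈ₗ_)
open import Data.List.Relation.Unary.Unique.Propositional using (Unique)
open import Relation.Nullary using (¬_; does)
open import Relation.Binary.PropositionalEquality using (_≡_; _≢_)
open import Function.Definitions using (Injective)

-- Finite hypergraph on vertex set Fin n with m hyperedges, given as an
-- injective family Fin m → Subset n (so the hyperedges form a set).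

record Hypergraph (n m : ℕ) : Set where
  field
    edge     : Fin m → Subset n
    distinct : Injective _≡_ _≡_ edge
open Hypergraph public

meets : ∀ {n} → Subset n → Subset n → Bool
meets A B = does (nonempty? (A ∩ B))

neighbours : ∀ {n m} → Hypergraph n m → Fin m → Subset m
neighbours H e = tabulate λ e′ →
  if does (e′ ≟ e) then false else meets (edge H e) (edge H e′)

degree : ∀ {n m} → Hypergraph n m → Fin m → ℕ
degree H e = ∣ neighbours H e ∣

record Assignment (n k : ℕ) : Set where
  field
    list   : Fin n → List ℕ
    size   : ∀ v → length (list v) ≡ k
    unique : ∀ v → Unique (list v)
open Assignment public

IsLCFColouring : ∀ {n m k} → Hypergraph n m → Assignment n k → (Fin n → ℕ) → Set
IsLCFColouring H L f =
  (∀ v → f v ∈ₗ list L v) ×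
  (∀ e → ∃ λ v → v ∈ edge H e × (∀ w → w ∈ edge H e → w ≢ v → f w ≢ f v))

CFChoosable : ∀ {n m} → Hypergraph n m → ℕ → Set
CFChoosable {n} H k = (L : Assignment n k) → ∃ λ f → IsLCFColouring H L f

chCF≤ : ∀ {n m} → Hypergraph n m → ℕ → Set
chCF≤ H b = ∃ λ k → k ≤ b × CFChoosable H k

-- For x, c : ℕ with c ≥ 1, the partial sums of exp(x/c) are
--   S_N = Σ_{j ≤ N} (x/c)^j / j!  =  expNum c x N / (c^N * N!)
-- where expNum c x 0 = 1, expNum c x (N+1) = c (N+1) expNum c x N + x^(N+1).
expNum : ℕ → ℕ → ℕ → ℕ
expNum c x zero    = 1
expNum c x (suc N) = c * suc N * expNum c x N + x ^ suc N

-- "c * ln y ≤ x", i.e. y ≤ exp(x/c).  Since exp(x/c) is irrational for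
-- x > 0 (and equals 1 for x = 0), this holds iff some partial sum S_N ≥ y.
CLnLe : ℕ → ℕ → ℕ → Set
CLnLe c y x = ∃ λ N → y * (c ^ N * N !) ≤ expNum c x N

-- α ≤ s  where α = max(2^12, ⌈136 ln(16 Γ)⌉); for integer s this is
-- 2^12 ≤ s and 136 ln(16Γ) ≤ s.
AlphaLe : ℕ → ℕ → Set
AlphaLe Γ s = 2 ^ 12 ≤ s × CLnLe 136 (16 * Γ) s

{-# OPTIONS --safe #-}
-- Choose, independently and uniformly, an index into the list of every vertex; with k = 32β
-- this is a uniformly random L-colouring, and probabilities are counts over the k ^ n index
-- vectors.  If an edge E of size s has no uniquely coloured vertex, every colour on E repeats,
-- so at least ⌈s/2⌉ vertices of E share their colour with a later vertex of E.  The lists have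
-- no repetitions, so a vertex takes one prescribed colour with probability at most 1/k, and
-- this event has probability at most 2^s (s/k)^⌈s/2⌉ ≤ 1/(4Γ), using 16Γ ≤ 2^s (which is what
-- 136 ln(16Γ) ≤ s gives) and 16s ≤ k.  The event of E depends only on the indices chosen on E,
-- so it is mutually independent of the events of the edges disjoint from E, and at most Γ
-- other edges meet E.  The symmetric local lemma (p ≤ 1/(4Γ)) then gives a colouring in which every edge
-- has a uniquely coloured vertex.
module Submission where

open import Defs
open import Data.Bool using (true; false; if_then_else_)
open import Data.Fin using (Fin; zero; suc; cast; toℕ)
import Data.Fin.Properties as Fin
open import Data.Fin.Subset
  using (Subset; inside; outside; ⊤; _∈_; _∉_; _⊆_; _∩_; _─_; _-_; ⁅_⁆; ∁; ∣_∣; Empty)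
open import Data.Fin.Subset.Properties
  using (_∈?_; nonempty?; drop-there; ∈⊤; p─q⊆p; p∩q≢∅⇒∣p─q∣<∣p∣; x∈p∩q⁺; x∈p∩q⁻;
         ∣p∩q∣≤∣q∣; x∈p∧x∉q⇒x∈p─q; x∈p⇒∣p-x∣<∣p∣; x∈p∧x≢y⇒x∈p-y; x∈⁅x⁆; x∈⁅y⁆⇒x≡y;
         ∣⁅x⁆∣≡1; x∉p⇒x∈∁p)
open import Data.List using (List; []; _∷_; length; filter) renaming (lookup to lookupₗ)
open import Data.List.Membership.Propositional using (find) renaming (_∈_ to _∈ₗ_)
open import Data.List.Membership.Propositional.Properties using (∈-filter⁻; ∈-filter⁺; ∈-lookup)
open import Data.List.Relation.Unary.All as All using (All)
open import Data.List.Relation.Unary.All.Properties using (¬All⇒Any¬)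
open import Data.List.Relation.Unary.Any using (here; there)
open import Data.List.Relation.Unary.Unique.Propositional using (Unique; _∷_)
open import Data.Nat
open import Data.Nat.Properties
open import Data.Nat.Solver using (module +-*-Solver)
open import Data.Product using (∃; _×_; _,_; proj₁; proj₂)
open import Data.Sum using (_⊎_; inj₁; inj₂)
open import Data.Vec using (Vec; []; _∷_; lookup; here; there)
open import Data.Vec.Properties using (lookup∘tabulate; lookup⇒[]=)
open import Function using (_∘_)
open import Function.Definitions using (Injective)
open import Relation.Binary.Definitions using (DecidableEquality)
open import Relation.Binary.PropositionalEquality
open import Relation.Nullary using (Dec; yes; no; does; ¬_; contradiction; ¬?; _×-dec_)
open import Algebra.Properties.CommutativeSemigroup *-commutativeSemigroup using (x∙yz≈y∙xz)
open import Algebra.Properties.Semiring.Sum +-*-semiring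
  using (sum; sum-syntax; sum-cong-≗; sum-replicate-zero; ∑-distrib-+; ∑-comm;
         *-distribˡ-sum; *-distribʳ-sum)

open +-*-Solver using (solve; _:*_; _:+_; _:=_; con)

private
  variable
    k m n : ℕ
    P Q : Set

𝟙 : Dec P → ℕ
𝟙 P? = if does P? then 1 else 0

𝟙-mono : (P? : Dec P) (Q? : Dec Q) → (P → Q) → 𝟙 P? ≤ 𝟙 Q?
𝟙-mono (yes p) (yes _) _   = ≤-refl
𝟙-mono (yes p) (no ¬q) p⇒q = contradiction (p⇒q p) ¬q
𝟙-mono (no _)  _       _   = z≤n

𝟙-cong : (P? : Dec P) (Q? : Dec Q) → (P → Q) → (Q → P) → 𝟙 P? ≡ 𝟙 Q?
𝟙-cong P? Q? p⇒q q⇒p = ≤-antisym (𝟙-mono P? Q? p⇒q) (𝟙-mono Q? P? q⇒p)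

𝟙≤1 : (P? : Dec P) → 𝟙 P? ≤ 1
𝟙≤1 (yes _) = ≤-refl
𝟙≤1 (no _)  = z≤n

𝟙-yes : (P? : Dec P) → P → 𝟙 P? ≡ 1
𝟙-yes (yes _) _ = refl
𝟙-yes (no ¬p) p = contradiction p ¬p

𝟙-no : (P? : Dec P) → ¬ P → 𝟙 P? ≡ 0
𝟙-no (yes p) ¬p = contradiction p ¬p
𝟙-no (no _)  _  = refl

𝟙>0⇒holds : (P? : Dec P) → 0 < 𝟙 P? → P
𝟙>0⇒holds (yes p) _ = p

∑-mono-≤ : {f g : Fin k → ℕ} → (∀ i → f i ≤ g i) → sum f ≤ sum g
∑-mono-≤ {zero}  f≤g = z≤n
∑-mono-≤ {suc k} f≤g = +-mono-≤ (f≤g zero) (∑-mono-≤ (f≤g ∘ suc))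

∑-const : ∀ k a → ∑[ i < k ] a ≡ k * a
∑-const zero    a = refl
∑-const (suc k) a = cong (a +_) (∑-const k a)

f≤∑f : (f : Fin k → ℕ) (i : Fin k) → f i ≤ sum f
f≤∑f f zero    = m≤m+n _ _
f≤∑f f (suc i) = ≤-trans (f≤∑f (f ∘ suc) i) (m≤n+m _ _)

∑>0⇒∃>0 : (f : Fin k → ℕ) → 0 < sum f → ∃ λ i → 0 < f i
∑>0⇒∃>0 {suc k} f ∑f>0 with f zero in eq
... | suc _ = zero , subst (0 <_) (sym eq) z<s
... | zero  = let i , fi>0 = ∑>0⇒∃>0 (f ∘ suc) ∑f>0 in suc i , fi>0

∑𝟙∈≡∣_∣ : (p : Subset k) → ∑[ i < k ] 𝟙 (i ∈? p) ≡ ∣ p ∣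
∑𝟙∈≡∣ []          ∣ = refl
∑𝟙∈≡∣ inside  ∷ p ∣ = cong suc (∑𝟙∈≡∣ p ∣)
∑𝟙∈≡∣ outside ∷ p ∣ = ∑𝟙∈≡∣ p ∣

∑𝟙∈*≤∣_∣* : (p : Subset k) {x : Fin k → ℕ} {a : ℕ} → (∀ i → i ∈ p → x i ≤ a) →
            ∑[ i < k ] (𝟙 (i ∈? p) * x i) ≤ ∣ p ∣ * a
∑𝟙∈*≤∣_∣* {k} p {x} {a} x≤a = begin
  ∑[ i < k ] (𝟙 (i ∈? p) * x i) ≤⟨ ∑-mono-≤ (λ i → bound i (i ∈? p)) ⟩
  ∑[ i < k ] (𝟙 (i ∈? p) * a)   ≡⟨ *-distribʳ-sum a (λ i → 𝟙 (i ∈? p)) ⟨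
  (∑[ i < k ] 𝟙 (i ∈? p)) * a   ≡⟨ cong (_* a) (∑𝟙∈≡∣ p ∣) ⟩
  ∣ p ∣ * a                     ∎
  where
  open ≤-Reasoning
  bound : ∀ i (i∈?p : Dec (i ∈ p)) → 𝟙 i∈?p * x i ≤ 𝟙 i∈?p * a
  bound i (yes i∈p) = *-monoʳ-≤ 1 (x≤a i i∈p)
  bound i (no _)    = z≤n

-- Counting measure on Vec (Fin k) n

count : ∀ {k n} → (Vec (Fin k) n → ℕ) → ℕ
count {k} {zero}  F = F []
count {k} {suc n} F = ∑[ c < k ] count (λ ω → F (c ∷ ω))

count-cong : {F G : Vec (Fin k) n → ℕ} → (∀ ω → F ω ≡ G ω) → count F ≡ count G
count-cong {n = zero}  F≗G = F≗G []
count-cong {n = suc n} F≗G = sum-cong-≗ λ c → count-cong λ ω → F≗G (c ∷ ω)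

count-mono-≤ : {F G : Vec (Fin k) n → ℕ} → (∀ ω → F ω ≤ G ω) → count F ≤ count G
count-mono-≤ {n = zero}  F≤G = F≤G []
count-mono-≤ {n = suc n} F≤G = ∑-mono-≤ λ c → count-mono-≤ λ ω → F≤G (c ∷ ω)

count-+ : (F G : Vec (Fin k) n → ℕ) → count (λ ω → F ω + G ω) ≡ count F + count G
count-+ {n = zero}  F G = refl
count-+ {n = suc n} F G = trans (sum-cong-≗ λ c → count-+ (λ ω → F (c ∷ ω)) (λ ω → G (c ∷ ω)))
                                (∑-distrib-+ (λ c → count λ ω → F (c ∷ ω)) (λ c → count λ ω → G (c ∷ ω)))

count-*ˡ : ∀ a (F : Vec (Fin k) n → ℕ) → count (λ ω → a * F ω) ≡ a * count F
count-*ˡ {n = zero}  a F = refl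
count-*ˡ {n = suc n} a F = trans (sum-cong-≗ λ c → count-*ˡ a (λ ω → F (c ∷ ω)))
                                 (sym (*-distribˡ-sum a λ c → count λ ω → F (c ∷ ω)))

count-const : ∀ {k} n a → count {k} {n} (λ _ → a) ≡ k ^ n * a
count-const zero    a = sym (*-identityˡ a)
count-const {k} (suc n) a = begin
  ∑[ c < k ] count {k} {n} (λ _ → a) ≡⟨ sum-cong-≗ {k} (λ _ → count-const {k} n a) ⟩
  ∑[ c < k ] (k ^ n * a)             ≡⟨ ∑-const k (k ^ n * a) ⟩
  k * (k ^ n * a)                    ≡⟨ *-assoc k (k ^ n) a ⟨
  k ^ suc n * a                      ∎
  where open ≡-Reasoning

count-∑ : (F : Fin m → Vec (Fin k) n → ℕ) → count (λ ω → ∑[ j < m ] F j ω) ≡ ∑[ j < m ] count (F j)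
count-∑ {n = zero}  F = refl
count-∑ {n = suc n} F = trans (sum-cong-≗ λ c → count-∑ λ j ω → F j (c ∷ ω))
                              (∑-comm λ c j → count λ ω → F j (c ∷ ω))

count>0⇒∃>0 : (F : Vec (Fin k) n → ℕ) → 0 < count F → ∃ λ ω → 0 < F ω
count>0⇒∃>0 {n = zero}  F F[]>0   = [] , F[]>0
count>0⇒∃>0 {n = suc n} F count>0 =
  let c , countᶜ>0 = ∑>0⇒∃>0 _ count>0
      ω , Fcω>0    = count>0⇒∃>0 (λ ω → F (c ∷ ω)) countᶜ>0
  in c ∷ ω , Fcω>0

count-head-irrelevant : (F : Vec (Fin k) (suc n) → ℕ) → (∀ c c′ ω → F (c ∷ ω) ≡ F (c′ ∷ ω)) →
                        ∀ c → count F ≡ k * count (λ ω → F (c ∷ ω))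
count-head-irrelevant {k} F F-irr c =
  trans (sum-cong-≗ λ c′ → count-cong (F-irr c′ c)) (∑-const k _)

Agree : Subset n → Vec (Fin k) n → Vec (Fin k) n → Set
Agree U ω ω′ = ∀ v → v ∈ U → lookup ω v ≡ lookup ω′ v

Agree-sym : ∀ {k n} {U : Subset n} {ω ω′ : Vec (Fin k) n} → Agree U ω ω′ → Agree U ω′ ω
Agree-sym agr v v∈U = sym (agr v v∈U)

DependsOnlyOn : Subset n → (Vec (Fin k) n → ℕ) → Set
DependsOnlyOn U F = ∀ {ω ω′} → Agree U ω ω′ → F ω ≡ F ω′

count-*-independent : (U : Subset n) {F G : Vec (Fin k) n → ℕ} →
                      DependsOnlyOn U F → DependsOnlyOn (∁ U) G →
                      count (λ ω → F ω * G ω) * k ^ n ≡ count F * count G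
count-*-independent [] {F} {G} _ _ = *-identityʳ (F [] * G [])
count-*-independent {suc n} {k} (s ∷ U) {F} {G} F-dep G-dep = begin
  count (λ ω → F ω * G ω) * (k * k ^ n)                  ≡⟨ *-distribʳ-sum (k * k ^ n) FGᶜ ⟩
  ∑[ c < k ] (FGᶜ c * (k * k ^ n))                        ≡⟨ sum-cong-≗ slice ⟩
  ∑[ c < k ] (k * (count (Fᶜ c) * count (Gᶜ c)))         ≡⟨ recombine s F-dep G-dep ⟩
  count F * count G                                       ∎
  where
  open ≡-Reasoning
  Fᶜ Gᶜ : Fin k → Vec (Fin k) n → ℕ
  Fᶜ c ω = F (c ∷ ω)
  Gᶜ c ω = G (c ∷ ω)
  FGᶜ : Fin k → ℕ
  FGᶜ c = count (λ ω → Fᶜ c ω * Gᶜ c ω)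
  fix-head : ∀ {s U} c {ω ω′} → Agree U ω ω′ → Agree (s ∷ U) (c ∷ ω) (c ∷ ω′)
  fix-head c agr zero    _           = refl
  fix-head c agr (suc v) (there v∈U) = agr v v∈U
  vary-head : ∀ {U} c c′ {ω} → Agree (outside ∷ U) (c ∷ ω) (c′ ∷ ω)
  vary-head c c′ (suc v) _ = refl
  slice : ∀ c → FGᶜ c * (k * k ^ n) ≡ k * (count (Fᶜ c) * count (Gᶜ c))
  slice c = trans (solve 3 (λ x k K → x :* (k :* K) := k :* (x :* K)) refl (FGᶜ c) k (k ^ n))
                  (cong (k *_) (count-*-independent U (λ agr → F-dep (fix-head c agr))
                                                      (λ agr → G-dep (fix-head c agr))))
  recombine : ∀ s → DependsOnlyOn (s ∷ U) F → DependsOnlyOn (∁ (s ∷ U)) G →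
              ∑[ c < k ] (k * (count (Fᶜ c) * count (Gᶜ c))) ≡ count F * count G
  recombine inside _ G-dep = begin
    ∑[ c < k ] (k * (count (Fᶜ c) * count (Gᶜ c)))  ≡⟨ sum-cong-≗ (λ c → x∙yz≈y∙xz k (count (Fᶜ c)) (count (Gᶜ c))) ⟩
    ∑[ c < k ] (count (Fᶜ c) * (k * count (Gᶜ c)))  ≡⟨ sum-cong-≗ (λ c → cong (count (Fᶜ c) *_)
                                                          (count-head-irrelevant G (λ c c′ _ → G-dep (vary-head c c′)) c)) ⟨
    ∑[ c < k ] (count (Fᶜ c) * count G)             ≡⟨ *-distribʳ-sum (count G) (count ∘ Fᶜ) ⟨
    count F * count G                               ∎
  recombine outside F-dep _ = begin
    ∑[ c < k ] (k * (count (Fᶜ c) * count (Gᶜ c)))  ≡⟨ sum-cong-≗ (λ c → *-assoc k (count (Fᶜ c)) (count (Gᶜ c))) ⟨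
    ∑[ c < k ] (k * count (Fᶜ c) * count (Gᶜ c))    ≡⟨ sum-cong-≗ (λ c → cong (_* count (Gᶜ c))
                                                          (count-head-irrelevant F (λ c c′ _ → F-dep (vary-head c c′)) c)) ⟨
    ∑[ c < k ] (count F * count (Gᶜ c))             ≡⟨ *-distribˡ-sum (count F) (count ∘ Gᶜ) ⟨
    count F * count G                               ∎

-- The local lemma

x∈p─q⇒x∉q : ∀ {x : Fin n} (p q : Subset n) → x ∈ p ─ q → x ∉ q
x∈p─q⇒x∉q {x = zero}  (inside  ∷ p) (outside ∷ q) here ()
x∈p─q⇒x∉q {x = zero}  (outside ∷ p) (outside ∷ q) ()
x∈p─q⇒x∉q {x = zero}  (_       ∷ p) (inside  ∷ q) ()
x∈p─q⇒x∉q {x = suc x} (_       ∷ p) (_       ∷ q) (there x∈p─q) x∈q =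
  x∈p─q⇒x∉q p q x∈p─q (drop-there x∈q)

module Events {k n m : ℕ} (Bad : Fin m → Vec (Fin k) n → Set) (bad? : ∀ i ω → Dec (Bad i ω)) where

  Hits : Subset m → Vec (Fin k) n → Set
  Hits T ω = ∃ λ j → j ∈ T × Bad j ω

  avoid? : ∀ T ω → Dec (¬ Hits T ω)
  avoid? T ω = ¬? (Fin.any? λ j → j ∈? T ×-dec bad? j ω)

  #bad : Fin m → ℕ
  #bad i = count λ ω → 𝟙 (bad? i ω)

  #avoid : Subset m → ℕ
  #avoid T = count λ ω → 𝟙 (avoid? T ω)

  #bad∧avoid : Fin m → Subset m → ℕ
  #bad∧avoid i T = count λ ω → 𝟙 (bad? i ω) * 𝟙 (avoid? T ω)

  avoid-antitone : ∀ {T T′} → T ⊆ T′ → ∀ ω → 𝟙 (avoid? T′ ω) ≤ 𝟙 (avoid? T ω)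
  avoid-antitone T⊆T′ ω =
    𝟙-mono (avoid? _ ω) (avoid? _ ω) λ ¬hits (j , j∈T , bad) → ¬hits (j , T⊆T′ j∈T , bad)

  avoid-union-bound : ∀ {T T′ B} → (∀ {j} → j ∈ T → j ∈ T′ ⊎ j ∈ B) →
                      #avoid T′ ≤ #avoid T + ∑[ j < m ] (𝟙 (j ∈? B) * #bad∧avoid j T′)
  avoid-union-bound {T} {T′} {B} T⊆T′∪B = begin
    #avoid T′                                        ≤⟨ count-mono-≤ pointwise ⟩
    count (λ ω → 𝟙 (avoid? T ω) + blamed ω)          ≡⟨ count-+ (λ ω → 𝟙 (avoid? T ω)) blamed ⟩
    #avoid T + count blamed                          ≡⟨ cong (#avoid T +_) (count-∑ λ j ω → 𝟙 (j ∈? B) * bad∧avoid j ω) ⟩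
    #avoid T + ∑[ j < m ] count (λ ω → 𝟙 (j ∈? B) * bad∧avoid j ω)
      ≡⟨ cong (#avoid T +_) (sum-cong-≗ λ j → count-*ˡ (𝟙 (j ∈? B)) (bad∧avoid j)) ⟩
    #avoid T + ∑[ j < m ] (𝟙 (j ∈? B) * #bad∧avoid j T′) ∎
    where
    open ≤-Reasoning
    bad∧avoid : Fin m → Vec (Fin k) n → ℕ
    bad∧avoid j ω = 𝟙 (bad? j ω) * 𝟙 (avoid? T′ ω)
    blamed : Vec (Fin k) n → ℕ
    blamed ω = ∑[ j < m ] (𝟙 (j ∈? B) * bad∧avoid j ω)
    pointwise : ∀ ω → 𝟙 (avoid? T′ ω) ≤ 𝟙 (avoid? T ω) + blamed ω
    pointwise ω = by-cases (Fin.any? λ j → j ∈? T ×-dec bad? j ω)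
      where
      by-cases : (hits? : Dec (Hits T ω)) → 𝟙 (avoid? T′ ω) ≤ 𝟙 (¬? hits?) + blamed ω
      by-cases (no _) = ≤-trans (𝟙≤1 (avoid? T′ ω)) (m≤m+n 1 _)
      by-cases (yes (j , j∈T , bad)) with T⊆T′∪B j∈T
      ... | inj₁ j∈T′ = ≤-trans (≤-reflexive (𝟙-no (avoid? T′ ω) λ ¬hits → ¬hits (j , j∈T′ , bad))) z≤n
      ... | inj₂ j∈B  = begin
        𝟙 (avoid? T′ ω)              ≡⟨ blame ⟨
        𝟙 (j ∈? B) * bad∧avoid j ω  ≤⟨ f≤∑f (λ j → 𝟙 (j ∈? B) * bad∧avoid j ω) j ⟩
        blamed ω                     ≤⟨ m≤n+m _ 0 ⟩
        0 + blamed ω                 ∎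
        where
        blame : 𝟙 (j ∈? B) * bad∧avoid j ω ≡ 𝟙 (avoid? T′ ω)
        blame = trans (cong₂ (λ x y → x * (y * 𝟙 (avoid? T′ ω))) (𝟙-yes (j ∈? B) j∈B) (𝟙-yes (bad? j ω) bad))
                      (trans (*-identityˡ _) (*-identityˡ _))

-- Counting form of the symmetric local lemma with p ≤ 1/(4Γ).  conditional-bound is the usual
-- induction on ∣ T ∣: it says P(Bad i | no event of T occurs) ≤ 1/(2Γ) whenever i ∉ T.
module LocalLemma
  {k n m : ℕ} .{{_ : NonZero k}}
  (Bad : Fin m → Vec (Fin k) n → Set) (bad? : ∀ i ω → Dec (Bad i ω))
  (Γ : ℕ) .{{_ : NonZero Γ}} (adj : Fin m → Subset m)
  (sparse : ∀ i → ∣ adj i ∣ ≤ Γ)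
  (rare : ∀ i → 4 * Γ * Events.#bad Bad bad? i ≤ k ^ n)
  (independent : ∀ i T → i ∉ T → (∀ {j} → j ∈ T → j ∉ adj i) →
                 Events.#bad∧avoid Bad bad? i T * k ^ n ≡ Events.#bad Bad bad? i * Events.#avoid Bad bad? T)
  where

  open Events Bad bad?

  #bad∧avoid-antitone : ∀ {T T′} i → T ⊆ T′ → #bad∧avoid i T′ ≤ #bad∧avoid i T
  #bad∧avoid-antitone i T⊆T′ = count-mono-≤ λ ω → *-monoʳ-≤ (𝟙 (bad? i ω)) (avoid-antitone T⊆T′ ω)

  #bad∧avoid-nonadjacent : ∀ i T → i ∉ T → (∀ {j} → j ∈ T → j ∉ adj i) →
                           4 * Γ * #bad∧avoid i T ≤ #avoid T
  #bad∧avoid-nonadjacent i T i∉T T∩adj≡∅ = *-cancelʳ-≤ _ _ (k ^ n) {{m^n≢0 k n}} (begin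
    4 * Γ * #bad∧avoid i T * k ^ n    ≡⟨ *-assoc (4 * Γ) _ _ ⟩
    4 * Γ * (#bad∧avoid i T * k ^ n)  ≡⟨ cong (4 * Γ *_) (independent i T i∉T T∩adj≡∅) ⟩
    4 * Γ * (#bad i * #avoid T)       ≡⟨ *-assoc (4 * Γ) _ _ ⟨
    4 * Γ * #bad i * #avoid T         ≤⟨ *-monoˡ-≤ (#avoid T) (rare i) ⟩
    k ^ n * #avoid T                  ≡⟨ *-comm (k ^ n) _ ⟩
    #avoid T * k ^ n                  ∎)
    where open ≤-Reasoning

  avoid-nonadjacent≤2*avoid :
    ∀ T i → (∀ j → j ∈ T ∩ adj i → 4 * Γ * #bad∧avoid j (T ─ adj i) ≤ 2 * #avoid (T ─ adj i)) →
    #avoid (T ─ adj i) ≤ 2 * #avoid T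
  avoid-nonadjacent≤2*avoid T i IH =
    *-cancelˡ-≤ (2 * Γ) {{m*n≢0 2 Γ}} (+-cancelʳ-≤ (2 * Γ * N₂) _ _ (begin
      2 * Γ * N₂ + 2 * Γ * N₂       ≡⟨ solve 2 (λ g x → con 2 :* g :* x :+ con 2 :* g :* x := con 4 :* g :* x)
                                               refl Γ N₂ ⟩
      4 * Γ * N₂                    ≤⟨ *-monoʳ-≤ (4 * Γ) (avoid-union-bound split) ⟩
      4 * Γ * (N + blamed)          ≡⟨ *-distribˡ-+ (4 * Γ) N blamed ⟩
      4 * Γ * N + 4 * Γ * blamed    ≤⟨ +-monoʳ-≤ (4 * Γ * N) blamed-bound ⟩
      4 * Γ * N + Γ * (2 * N₂)      ≡⟨ solve 3 (λ g x y → con 4 :* g :* y :+ g :* (con 2 :* x)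
                                                     := con 2 :* g :* (con 2 :* y) :+ con 2 :* g :* x) refl Γ N₂ N ⟩
      2 * Γ * (2 * N) + 2 * Γ * N₂  ∎))
    where
    open ≤-Reasoning
    T₁ T₂ : Subset m
    T₁ = T ∩ adj i
    T₂ = T ─ adj i
    N N₂ blamed : ℕ
    N = #avoid T
    N₂ = #avoid T₂
    blamed = ∑[ j < m ] (𝟙 (j ∈? T₁) * #bad∧avoid j T₂)
    split : ∀ {j} → j ∈ T → j ∈ T₂ ⊎ j ∈ T₁
    split {j} j∈T with j ∈? adj i
    ... | yes j∈adj = inj₂ (x∈p∩q⁺ (j∈T , j∈adj))
    ... | no  j∉adj = inj₁ (x∈p∧x∉q⇒x∈p─q j∈T j∉adj)
    blamed-bound : 4 * Γ * blamed ≤ Γ * (2 * N₂)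
    blamed-bound = begin
      4 * Γ * blamed                                         ≡⟨ *-distribˡ-sum (4 * Γ) (λ j → 𝟙 (j ∈? T₁) * #bad∧avoid j T₂) ⟩
      ∑[ j < m ] (4 * Γ * (𝟙 (j ∈? T₁) * #bad∧avoid j T₂))  ≡⟨ sum-cong-≗ (λ j → x∙yz≈y∙xz (4 * Γ) (𝟙 (j ∈? T₁)) _) ⟩
      ∑[ j < m ] (𝟙 (j ∈? T₁) * (4 * Γ * #bad∧avoid j T₂))  ≤⟨ ∑𝟙∈*≤∣ T₁ ∣* IH ⟩
      ∣ T₁ ∣ * (2 * N₂)                                      ≤⟨ *-monoˡ-≤ (2 * N₂) (≤-trans (∣p∩q∣≤∣q∣ T (adj i)) (sparse i)) ⟩
      Γ * (2 * N₂)                                           ∎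

  conditional-step :
    ∀ T i → i ∉ T → (∀ j → j ∈ T ∩ adj i → 4 * Γ * #bad∧avoid j (T ─ adj i) ≤ 2 * #avoid (T ─ adj i)) →
    4 * Γ * #bad∧avoid i T ≤ 2 * #avoid T
  conditional-step T i i∉T IH = begin
    4 * Γ * #bad∧avoid i T           ≤⟨ *-monoʳ-≤ (4 * Γ) (#bad∧avoid-antitone i (p─q⊆p T (adj i))) ⟩
    4 * Γ * #bad∧avoid i (T ─ adj i) ≤⟨ #bad∧avoid-nonadjacent i (T ─ adj i) (i∉T ∘ p─q⊆p T (adj i))
                                                                              (x∈p─q⇒x∉q T (adj i)) ⟩
    #avoid (T ─ adj i)               ≤⟨ avoid-nonadjacent≤2*avoid T i IH ⟩
    2 * #avoid T                     ∎
    where open ≤-Reasoning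

  conditional-bound : ∀ t T i → ∣ T ∣ ≤ t → i ∉ T → 4 * Γ * #bad∧avoid i T ≤ 2 * #avoid T
  conditional-bound t T i ∣T∣≤t i∉T = conditional-step T i i∉T λ j j∈T∩adj →
    recurse t (<-≤-trans (p∩q≢∅⇒∣p─q∣<∣p∣ T (adj i) (j , j∈T∩adj)) ∣T∣≤t) j
            λ j∈T₂ → x∈p─q⇒x∉q T (adj i) j∈T₂ (proj₂ (x∈p∩q⁻ T (adj i) j∈T∩adj))
    where
    recurse : ∀ s → ∣ T ─ adj i ∣ < s → ∀ j → j ∉ T ─ adj i →
              4 * Γ * #bad∧avoid j (T ─ adj i) ≤ 2 * #avoid (T ─ adj i)
    recurse (suc s) (s≤s ∣T₂∣≤s) j = conditional-bound s (T ─ adj i) j ∣T₂∣≤s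

  avoid-remove≤2*avoid : ∀ T i → i ∈ T → #avoid (T - i) ≤ 2 * #avoid T
  avoid-remove≤2*avoid T i i∈T = +-cancelʳ-≤ N′ _ _ (begin
    N′ + N′          ≡⟨ cong (N′ +_) (+-identityʳ N′) ⟨
    2 * N′           ≤⟨ *-monoʳ-≤ 2 (avoid-union-bound split) ⟩
    2 * (N + blamed) ≤⟨ *-monoʳ-≤ 2 (+-monoʳ-≤ N blamed≤Z) ⟩
    2 * (N + Z)      ≡⟨ *-distribˡ-+ 2 N Z ⟩
    2 * N + 2 * Z    ≤⟨ +-monoʳ-≤ (2 * N) 2Z≤N′ ⟩
    2 * N + N′       ∎)
    where
    open ≤-Reasoning
    T′ : Subset m
    T′ = T - i
    N N′ Z blamed : ℕ
    N = #avoid T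
    N′ = #avoid T′
    Z = #bad∧avoid i T′
    blamed = ∑[ j < m ] (𝟙 (j ∈? ⁅ i ⁆) * #bad∧avoid j T′)
    split : ∀ {j} → j ∈ T → j ∈ T′ ⊎ j ∈ ⁅ i ⁆
    split {j} j∈T with j Fin.≟ i
    ... | yes refl = inj₂ (x∈⁅x⁆ i)
    ... | no  j≢i  = inj₁ (x∈p∧x≢y⇒x∈p-y j∈T j≢i)
    blamed≤Z : blamed ≤ Z
    blamed≤Z = begin
      blamed        ≤⟨ ∑𝟙∈*≤∣ ⁅ i ⁆ ∣* (λ j j∈⁅i⁆ → ≤-reflexive (cong (λ j → #bad∧avoid j T′) (x∈⁅y⁆⇒x≡y i j∈⁅i⁆))) ⟩
      ∣ ⁅ i ⁆ ∣ * Z ≡⟨ cong (_* Z) (∣⁅x⁆∣≡1 i) ⟩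
      1 * Z         ≡⟨ *-identityˡ Z ⟩
      Z             ∎
    2Z≤N′ : 2 * Z ≤ N′
    2Z≤N′ = *-cancelˡ-≤ 2 (begin
      2 * (2 * Z) ≡⟨ *-assoc 2 2 Z ⟨
      4 * Z       ≤⟨ *-monoˡ-≤ Z (*-monoʳ-≤ 4 (>-nonZero⁻¹ Γ)) ⟩
      4 * Γ * Z   ≤⟨ conditional-bound ∣ T′ ∣ T′ i ≤-refl (λ i∈T′ → x∈p─q⇒x∉q T ⁅ i ⁆ i∈T′ (x∈⁅x⁆ i)) ⟩
      2 * N′      ∎)

  #avoid-empty>0 : ∀ T → Empty T → 0 < #avoid T
  #avoid-empty>0 T T≡∅ = begin-strict
    0                       <⟨ m^n>0 k n ⟩
    k ^ n                   ≡⟨ *-identityʳ (k ^ n) ⟨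
    k ^ n * 1               ≡⟨ count-const {k} n 1 ⟨
    count {k} {n} (λ _ → 1) ≡⟨ count-cong (λ ω → 𝟙-yes (avoid? T ω) λ (j , j∈T , _) → T≡∅ (j , j∈T)) ⟨
    #avoid T                ∎
    where open ≤-Reasoning

  #avoid>0 : ∀ t T → ∣ T ∣ ≤ t → 0 < #avoid T
  #avoid>0 zero    T ∣T∣≤0 = #avoid-empty>0 T λ (i , i∈T) → n≮0 (<-≤-trans (x∈p⇒∣p-x∣<∣p∣ i∈T) ∣T∣≤0)
  #avoid>0 (suc t) T ∣T∣≤1+t with nonempty? T
  ... | no  T≡∅       = #avoid-empty>0 T T≡∅
  ... | yes (i , i∈T) = *-cancelˡ-< 2 0 (#avoid T) (<-≤-trans
                          (#avoid>0 t (T - i) (≤-pred (<-≤-trans (x∈p⇒∣p-x∣<∣p∣ i∈T) ∣T∣≤1+t)))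
                          (avoid-remove≤2*avoid T i i∈T))

  avoid-all : ∃ λ ω → ∀ i → ¬ Bad i ω
  avoid-all =
    let ω , 𝟙[avoid]>0 = count>0⇒∃>0 (λ ω → 𝟙 (avoid? ⊤ ω)) (#avoid>0 _ ⊤ ≤-refl)
    in ω , λ i bad → 𝟙>0⇒holds (avoid? ⊤ ω) 𝟙[avoid]>0 (i , ∈⊤ , bad)

lovász-local-lemma :
  ∀ {k n m} .{{_ : NonZero k}} (Bad : Fin m → Vec (Fin k) n → Set) (bad? : ∀ i ω → Dec (Bad i ω))
  (support : Fin m → Subset n) → (∀ i {ω ω′} → Agree (support i) ω ω′ → Bad i ω → Bad i ω′) →
  (Γ : ℕ) .{{_ : NonZero Γ}} (adj : Fin m → Subset m) → (∀ i → ∣ adj i ∣ ≤ Γ) →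
  (∀ {i j} → j ≢ i → j ∉ adj i → Empty (support i ∩ support j)) →
  (∀ i → 4 * Γ * Events.#bad Bad bad? i ≤ k ^ n) →
  ∃ λ ω → ∀ i → ¬ Bad i ω
lovász-local-lemma {k} {n} Bad bad? support supported Γ adj sparse nonadjacent-disjoint rare =
  LocalLemma.avoid-all Bad bad? Γ adj sparse rare independent
  where
  open Events Bad bad?
  independent : ∀ i T → i ∉ T → (∀ {j} → j ∈ T → j ∉ adj i) → #bad∧avoid i T * k ^ n ≡ #bad i * #avoid T
  independent i T i∉T T∩adj≡∅ = count-*-independent (support i) bad-dep avoid-dep
    where
    bad-dep : DependsOnlyOn (support i) (λ ω → 𝟙 (bad? i ω))
    bad-dep {ω} {ω′} agr =
      𝟙-cong (bad? i ω) (bad? i ω′) (supported i agr) (supported i (Agree-sym {ω = ω} {ω′} agr))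
    outside-i : ∀ {ω ω′} → Agree (∁ (support i)) ω ω′ → ∀ {j} → j ∈ T → Agree (support j) ω ω′
    outside-i agr {j} j∈T v v∈sⱼ = agr v (x∉p⇒x∈∁p λ v∈sᵢ →
      nonadjacent-disjoint (λ { refl → i∉T j∈T }) (T∩adj≡∅ j∈T) (v , x∈p∩q⁺ (v∈sᵢ , v∈sⱼ)))
    avoid-dep : DependsOnlyOn (∁ (support i)) (λ ω → 𝟙 (avoid? T ω))
    avoid-dep {ω} {ω′} agr = 𝟙-cong (avoid? T ω) (avoid? T ω′)
      (λ ¬hits (j , j∈T , bad) → ¬hits (j , j∈T , supported j (outside-i {ω′} {ω} (Agree-sym {ω = ω} {ω′} agr) j∈T) bad))
      (λ ¬hits (j , j∈T , bad) → ¬hits (j , j∈T , supported j (outside-i {ω} {ω′} agr j∈T) bad))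

valuesOn : ∀ {A : Set} → Subset n → (Fin n → A) → List A
valuesOn []            f = []
valuesOn (inside  ∷ U) f = f zero ∷ valuesOn U (f ∘ suc)
valuesOn (outside ∷ U) f = valuesOn U (f ∘ suc)

module _ {A : Set} where

  length-valuesOn : (U : Subset n) (f : Fin n → A) → length (valuesOn U f) ≡ ∣ U ∣
  length-valuesOn []            f = refl
  length-valuesOn (inside  ∷ U) f = cong suc (length-valuesOn U (f ∘ suc))
  length-valuesOn (outside ∷ U) f = length-valuesOn U (f ∘ suc)

  valuesOn-cong : (U : Subset n) {f g : Fin n → A} → (∀ {v} → v ∈ U → f v ≡ g v) →
                  valuesOn U f ≡ valuesOn U g
  valuesOn-cong []            f≗g = refl
  valuesOn-cong (inside  ∷ U) f≗g = cong₂ _∷_ (f≗g here) (valuesOn-cong U (f≗g ∘ there))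
  valuesOn-cong (outside ∷ U) f≗g = valuesOn-cong U (f≗g ∘ there)

  ∈-valuesOn⁻ : (U : Subset n) (f : Fin n → A) {z : A} → z ∈ₗ valuesOn U f → ∃ λ v → v ∈ U × f v ≡ z
  ∈-valuesOn⁻ (inside  ∷ U) f (here refl) = zero , here , refl
  ∈-valuesOn⁻ (inside  ∷ U) f (there z∈)  = let v , v∈U , fv≡z = ∈-valuesOn⁻ U (f ∘ suc) z∈ in suc v , there v∈U , fv≡z
  ∈-valuesOn⁻ (outside ∷ U) f z∈          = let v , v∈U , fv≡z = ∈-valuesOn⁻ U (f ∘ suc) z∈ in suc v , there v∈U , fv≡z

  ∈-valuesOn⁺ : (U : Subset n) (f : Fin n → A) {v : Fin n} → v ∈ U → f v ∈ₗ valuesOn U f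
  ∈-valuesOn⁺ (inside  ∷ U) f here        = here refl
  ∈-valuesOn⁺ (inside  ∷ U) f (there v∈U) = there (∈-valuesOn⁺ U (f ∘ suc) v∈U)
  ∈-valuesOn⁺ (outside ∷ U) f (there v∈U) = ∈-valuesOn⁺ U (f ∘ suc) v∈U

module Multiplicity {A : Set} (_≟_ : DecidableEquality A) where

  open import Data.List.Membership.DecPropositional _≟_ public using () renaming (_∈?_ to _∈ₗ?_)

  multiplicity : A → List A → ℕ
  multiplicity z []       = 0
  multiplicity z (x ∷ xs) = 𝟙 (z ≟ x) + multiplicity z xs

  repeats : List A → ℕ
  repeats []       = 0
  repeats (x ∷ xs) = 𝟙 (x ∈ₗ? xs) + repeats xs

  AllRepeated : List A → Set
  AllRepeated xs = All (λ z → 2 ≤ multiplicity z xs) xs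

  allRepeated? : ∀ xs → Dec (AllRepeated xs)
  allRepeated? xs = All.all? (λ z → 2 ≤? multiplicity z xs) xs

  removeAll : A → List A → List A
  removeAll x = filter (¬? ∘ (x ≟_))

  length-removeAll : ∀ x xs → length (removeAll x xs) + multiplicity x xs ≡ length xs
  length-removeAll x []       = refl
  length-removeAll x (y ∷ ys) with x ≟ y
  ... | yes refl = trans (+-suc _ _) (cong suc (length-removeAll x ys))
  ... | no  _    = cong suc (length-removeAll x ys)

  multiplicity-removeAll : ∀ {x z} xs → z ≢ x → multiplicity z (removeAll x xs) ≡ multiplicity z xs
  multiplicity-removeAll {x} {z} []       z≢x = refl
  multiplicity-removeAll {x} {z} (y ∷ ys) z≢x with x ≟ y
  ... | yes refl = trans (multiplicity-removeAll ys z≢x) (sym (cong (_+ multiplicity z ys) (𝟙-no (z ≟ x) z≢x)))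
  ... | no  _    = cong (𝟙 (z ≟ y) +_) (multiplicity-removeAll ys z≢x)

  𝟙∈removeAll : ∀ {x y} ys → y ≢ x → 𝟙 (y ∈ₗ? removeAll x ys) ≡ 𝟙 (y ∈ₗ? ys)
  𝟙∈removeAll {x} {y} ys y≢x = 𝟙-cong (y ∈ₗ? removeAll x ys) (y ∈ₗ? ys)
    (proj₁ ∘ ∈-filter⁻ (¬? ∘ (x ≟_))) (λ y∈ys → ∈-filter⁺ (¬? ∘ (x ≟_)) y∈ys (y≢x ∘ sym))

  repeats-removeAll : ∀ x xs → repeats xs + 𝟙 (x ∈ₗ? xs) ≡ repeats (removeAll x xs) + multiplicity x xs
  repeats-removeAll x []       = refl
  repeats-removeAll x (y ∷ ys) with x ≟ y
  ... | yes refl = begin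
    𝟙 (x ∈ₗ? ys) + repeats ys + 1                       ≡⟨ +-comm _ 1 ⟩
    suc (𝟙 (x ∈ₗ? ys) + repeats ys)                     ≡⟨ cong suc (+-comm (𝟙 (x ∈ₗ? ys)) _) ⟩
    suc (repeats ys + 𝟙 (x ∈ₗ? ys))                     ≡⟨ cong suc (repeats-removeAll x ys) ⟩
    suc (repeats (removeAll x ys) + multiplicity x ys)  ≡⟨ +-suc _ _ ⟨
    repeats (removeAll x ys) + suc (multiplicity x ys)  ∎
    where open ≡-Reasoning
  ... | no  x≢y  = begin
    𝟙 (y ∈ₗ? ys) + repeats ys + 𝟙 (x ∈ₗ? ys)
      ≡⟨ +-assoc (𝟙 (y ∈ₗ? ys)) _ _ ⟩
    𝟙 (y ∈ₗ? ys) + (repeats ys + 𝟙 (x ∈ₗ? ys))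
      ≡⟨ cong₂ _+_ (sym (𝟙∈removeAll ys (x≢y ∘ sym))) (repeats-removeAll x ys) ⟩
    𝟙 (y ∈ₗ? removeAll x ys) + (repeats (removeAll x ys) + multiplicity x ys)
      ≡⟨ +-assoc (𝟙 (y ∈ₗ? removeAll x ys)) _ _ ⟨
    𝟙 (y ∈ₗ? removeAll x ys) + repeats (removeAll x ys) + multiplicity x ys ∎
    where open ≡-Reasoning

  length≤2*repeats : ∀ t xs → length xs ≤ t → AllRepeated xs → length xs ≤ 2 * repeats xs
  length≤2*repeats _       []          _        _   = z≤n
  length≤2*repeats (suc t) xs@(x ∷ ys) ∣xs∣≤1+t rep = +-cancelʳ-≤ 2 _ _ (begin
    length xs + 2                   ≡⟨ cong (_+ 2) (length-removeAll x xs) ⟨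
    length xs′ + c + 2              ≤⟨ +-monoˡ-≤ 2 (+-monoˡ-≤ c IH) ⟩
    2 * repeats xs′ + c + 2         ≤⟨ +-monoʳ-≤ (2 * repeats xs′ + c) c≥2 ⟩
    2 * repeats xs′ + c + c         ≡⟨ solve 2 (λ r c → con 2 :* r :+ c :+ c := con 2 :* (r :+ c)) refl (repeats xs′) c ⟩
    2 * (repeats xs′ + c)           ≡⟨ cong (2 *_) (repeats-removeAll x xs) ⟨
    2 * (repeats xs + 𝟙 (x ∈ₗ? xs)) ≡⟨ cong (λ b → 2 * (repeats xs + b)) (𝟙-yes (x ∈ₗ? xs) (here refl)) ⟩
    2 * (repeats xs + 1)            ≡⟨ solve 1 (λ r → con 2 :* (r :+ con 1) := con 2 :* r :+ con 2) refl (repeats xs) ⟩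
    2 * repeats xs + 2              ∎)
    where
    open ≤-Reasoning
    xs′ = removeAll x xs
    c = multiplicity x xs
    c≥2 : 2 ≤ c
    c≥2 = All.lookup rep (here refl)
    shorter : length xs′ < length xs
    shorter = subst (length xs′ <_) (length-removeAll x xs) (m<m+n (length xs′) (≤-trans (s≤s z≤n) c≥2))
    rep′ : AllRepeated xs′
    rep′ = All.tabulate λ {z} z∈xs′ →
      let z∈xs , x≢z = ∈-filter⁻ (¬? ∘ (x ≟_)) z∈xs′
      in subst (2 ≤_) (sym (multiplicity-removeAll xs (x≢z ∘ sym))) (All.lookup rep z∈xs)
    IH : length xs′ ≤ 2 * repeats xs′
    IH = length≤2*repeats t xs′ (≤-pred (≤-trans shorter ∣xs∣≤1+t)) rep′

  ∈⇒1≤multiplicity : ∀ {z xs} → z ∈ₗ xs → 1 ≤ multiplicity z xs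
  ∈⇒1≤multiplicity {z} (here refl)  = ≤-trans (≤-reflexive (sym (𝟙-yes (z ≟ z) refl))) (m≤m+n _ _)
  ∈⇒1≤multiplicity     (there z∈ys) = ≤-trans (∈⇒1≤multiplicity z∈ys) (m≤n+m _ _)

  multiplicity-valuesOn≥2 : (U : Subset n) (f : Fin n → A) {v w : Fin n} → v ≢ w → v ∈ U → w ∈ U →
                            f v ≡ f w → 2 ≤ multiplicity (f v) (valuesOn U f)
  multiplicity-valuesOn≥2 (inside ∷ U) f {zero}  {zero}  v≢w _ _ _ = contradiction refl v≢w
  multiplicity-valuesOn≥2 (inside ∷ U) f {zero}  {suc w} _ _ (there w∈U) f0≡fw
    rewrite 𝟙-yes (f zero ≟ f zero) refl =
      s≤s (∈⇒1≤multiplicity (subst (_∈ₗ valuesOn U (f ∘ suc)) (sym f0≡fw) (∈-valuesOn⁺ U (f ∘ suc) w∈U)))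
  multiplicity-valuesOn≥2 (inside ∷ U) f {suc v} {zero}  _ (there v∈U) _ fv≡f0
    rewrite 𝟙-yes (f (suc v) ≟ f zero) fv≡f0 = s≤s (∈⇒1≤multiplicity (∈-valuesOn⁺ U (f ∘ suc) v∈U))
  multiplicity-valuesOn≥2 (inside ∷ U) f {suc v} {suc w} v≢w (there v∈U) (there w∈U) fv≡fw =
    ≤-trans (multiplicity-valuesOn≥2 U (f ∘ suc) (v≢w ∘ cong suc) v∈U w∈U fv≡fw) (m≤n+m _ _)
  multiplicity-valuesOn≥2 (outside ∷ U) f {suc v} {suc w} v≢w (there v∈U) (there w∈U) fv≡fw =
    multiplicity-valuesOn≥2 U (f ∘ suc) (v≢w ∘ cong suc) v∈U w∈U fv≡fw

  ∑𝟙≡≤1 : (g : Fin k → A) → Injective _≡_ _≡_ g → ∀ y → ∑[ c < k ] 𝟙 (g c ≟ y) ≤ 1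
  ∑𝟙≡≤1 {zero}  g g-inj y = z≤n
  ∑𝟙≡≤1 {suc k} g g-inj y with g zero ≟ y
  ... | yes refl = ≤-reflexive (cong suc (trans (sum-cong-≗ others) (sum-replicate-zero k)))
    where
    others : ∀ c → 𝟙 (g (suc c) ≟ g zero) ≡ 0
    others c = 𝟙-no (g (suc c) ≟ g zero) λ eq → Fin.0≢1+n (sym (g-inj eq))
  ... | no  _    = ∑𝟙≡≤1 (g ∘ suc) (Fin.suc-injective ∘ g-inj) y

  𝟙∈∷≤ : ∀ x y ys → 𝟙 (x ∈ₗ? y ∷ ys) ≤ 𝟙 (x ≟ y) + 𝟙 (x ∈ₗ? ys)
  𝟙∈∷≤ x y ys with x ≟ y
  ... | yes _ = s≤s z≤n
  ... | no  _ = ≤-refl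

  ∑𝟙∈≤length : (g : Fin k → A) → Injective _≡_ _≡_ g → ∀ ys → ∑[ c < k ] 𝟙 (g c ∈ₗ? ys) ≤ length ys
  ∑𝟙∈≤length {k} g g-inj []       = ≤-reflexive (sum-replicate-zero k)
  ∑𝟙∈≤length {k} g g-inj (y ∷ ys) = begin
    ∑[ c < k ] 𝟙 (g c ∈ₗ? y ∷ ys)                        ≤⟨ ∑-mono-≤ (λ c → 𝟙∈∷≤ (g c) y ys) ⟩
    ∑[ c < k ] (𝟙 (g c ≟ y) + 𝟙 (g c ∈ₗ? ys))            ≡⟨ ∑-distrib-+ (λ c → 𝟙 (g c ≟ y)) (λ c → 𝟙 (g c ∈ₗ? ys)) ⟩
    ∑[ c < k ] 𝟙 (g c ≟ y) + ∑[ c < k ] 𝟙 (g c ∈ₗ? ys)   ≤⟨ +-mono-≤ (∑𝟙≡≤1 g g-inj y) (∑𝟙∈≤length g g-inj ys) ⟩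
    suc (length ys)                                      ∎
    where open ≤-Reasoning

open Multiplicity _≟_

-- Edges without a unique colour

colouring : (Fin n → Fin k → ℕ) → Vec (Fin k) n → Fin n → ℕ
colouring palette ω v = palette v (lookup ω v)

𝟙≤?-suc : ∀ r R (P? : Dec P) → 𝟙 (suc r ≤? 𝟙 P? + R) ≤ 𝟙 (suc r ≤? R) + 𝟙 P? * 𝟙 (r ≤? R)
𝟙≤?-suc r R (no _)  = m≤m+n _ 0
𝟙≤?-suc r R (yes _) = begin
  𝟙 (suc r ≤? suc R)                 ≡⟨ 𝟙-cong (suc r ≤? suc R) (r ≤? R) s≤s⁻¹ s≤s ⟩
  𝟙 (r ≤? R)                         ≡⟨ +-identityʳ _ ⟨
  𝟙 (r ≤? R) + 0                     ≤⟨ m≤n+m _ (𝟙 (suc r ≤? R)) ⟩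
  𝟙 (suc r ≤? R) + (𝟙 (r ≤? R) + 0)  ∎
  where open ≤-Reasoning

module _ (palette : Fin (suc n) → Fin k → ℕ) (palette-injective : ∀ v → Injective _≡_ _≡_ (palette v))
         (U : Subset n) (r : ℕ) where

  private
    rest : Vec (Fin k) n → List ℕ
    rest = valuesOn U ∘ colouring (palette ∘ suc)
    B : Vec (Fin k) n → ℕ
    B ω = 𝟙 (r ≤? repeats (rest ω))
    hit : Fin k → Vec (Fin k) n → ℕ
    hit c ω = 𝟙 (palette zero c ∈ₗ? rest ω)

  -- The colour of the first vertex of U is among the later ones for at most ∣ U ∣ of the k
  -- choices of its index, because palette zero is injective.
  count-repeats-∷ : count (λ ω → 𝟙 (suc r ≤? repeats (valuesOn (inside ∷ U) (colouring palette ω))))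
                    ≤ k * count (λ ω → 𝟙 (suc r ≤? repeats (rest ω))) + ∣ U ∣ * count B
  count-repeats-∷ = begin
    ∑[ c < k ] count (λ ω → 𝟙 (suc r ≤? hit c ω + repeats (rest ω)))
      ≤⟨ ∑-mono-≤ (λ c → count-mono-≤ λ ω → 𝟙≤?-suc r _ (palette zero c ∈ₗ? rest ω)) ⟩
    ∑[ c < k ] count (λ ω → 𝟙 (suc r ≤? repeats (rest ω)) + hit c ω * B ω)
      ≡⟨ sum-cong-≗ (λ c → count-+ (λ ω → 𝟙 (suc r ≤? repeats (rest ω))) (λ ω → hit c ω * B ω)) ⟩
    ∑[ c < k ] (A + count (λ ω → hit c ω * B ω))
      ≡⟨ ∑-distrib-+ (λ _ → A) (λ c → count (λ ω → hit c ω * B ω)) ⟩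
    ∑[ c < k ] A + ∑[ c < k ] count (λ ω → hit c ω * B ω)
      ≡⟨ cong₂ _+_ (∑-const k A) (sym (count-∑ (λ c ω → hit c ω * B ω))) ⟩
    k * A + count (λ ω → ∑[ c < k ] (hit c ω * B ω))
      ≤⟨ +-monoʳ-≤ (k * A) (count-mono-≤ hits≤∣U∣) ⟩
    k * A + count (λ ω → ∣ U ∣ * B ω)
      ≡⟨ cong (k * A +_) (count-*ˡ ∣ U ∣ B) ⟩
    k * A + ∣ U ∣ * count B
      ∎
    where
    open ≤-Reasoning
    A : ℕ
    A = count (λ ω → 𝟙 (suc r ≤? repeats (rest ω)))
    hits≤∣U∣ : ∀ ω → ∑[ c < k ] (hit c ω * B ω) ≤ ∣ U ∣ * B ω
    hits≤∣U∣ ω = begin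
      ∑[ c < k ] (hit c ω * B ω)    ≡⟨ *-distribʳ-sum (B ω) (λ c → hit c ω) ⟨
      (∑[ c < k ] hit c ω) * B ω    ≤⟨ *-monoˡ-≤ (B ω) (∑𝟙∈≤length (palette zero) (palette-injective zero) (rest ω)) ⟩
      length (rest ω) * B ω         ≡⟨ cong (_* B ω) (length-valuesOn U _) ⟩
      ∣ U ∣ * B ω                   ∎

count-repeats≥ : (palette : Fin n → Fin k → ℕ) → (∀ v → Injective _≡_ _≡_ (palette v)) → ∀ U r →
                 count (λ ω → 𝟙 (r ≤? repeats (valuesOn U (colouring palette ω)))) * k ^ r
                   ≤ 2 ^ ∣ U ∣ * ∣ U ∣ ^ r * k ^ n
count-repeats≥ {n} {k} palette _ U zero = begin
  count {k} {n} (λ _ → 1) * 1 ≡⟨ *-identityʳ _ ⟩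
  count {k} {n} (λ _ → 1)     ≡⟨ count-const n 1 ⟩
  k ^ n * 1                   ≡⟨ *-identityʳ _ ⟩
  k ^ n                       ≤⟨ m≤n*m (k ^ n) (2 ^ ∣ U ∣) {{m^n≢0 2 ∣ U ∣}} ⟩
  2 ^ ∣ U ∣ * k ^ n           ≡⟨ cong (_* k ^ n) (*-identityʳ (2 ^ ∣ U ∣)) ⟨
  2 ^ ∣ U ∣ * 1 * k ^ n       ∎
  where open ≤-Reasoning
count-repeats≥ {zero} palette _ [] (suc r) = z≤n
count-repeats≥ {suc n} {k} palette palette-injective (outside ∷ U) r = begin
  (∑[ c < k ] X) * k ^ r      ≡⟨ cong (_* k ^ r) (∑-const k X) ⟩
  k * X * k ^ r               ≡⟨ *-assoc k X (k ^ r) ⟩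
  k * (X * k ^ r)             ≤⟨ *-monoʳ-≤ k (count-repeats≥ (palette ∘ suc) (palette-injective ∘ suc) U r) ⟩
  k * (2 ^ s * s ^ r * k ^ n) ≡⟨ solve 3 (λ k a b → k :* (a :* b) := a :* (k :* b)) refl k (2 ^ s * s ^ r) (k ^ n) ⟩
  2 ^ s * s ^ r * (k * k ^ n) ∎
  where
  open ≤-Reasoning
  s = ∣ U ∣
  X = count (λ ω → 𝟙 (r ≤? repeats (valuesOn U (colouring (palette ∘ suc) ω))))
count-repeats≥ {suc n} {k} palette palette-injective (inside ∷ U) (suc r) = begin
  count (λ ω → 𝟙 (suc r ≤? repeats (valuesOn (inside ∷ U) (colouring palette ω)))) * (k * k ^ r)
    ≤⟨ *-monoˡ-≤ (k * k ^ r) (count-repeats-∷ palette palette-injective U r) ⟩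
  (k * A + s * B) * (k * k ^ r)
    ≡⟨ solve 5 (λ k A s B K → (k :* A :+ s :* B) :* (k :* K) := k :* (A :* (k :* K)) :+ s :* k :* (B :* K))
               refl k A s B (k ^ r) ⟩
  k * (A * (k * k ^ r)) + s * k * (B * k ^ r)
    ≤⟨ +-mono-≤ (*-monoʳ-≤ k (count-repeats≥ (palette ∘ suc) (palette-injective ∘ suc) U (suc r)))
                (*-monoʳ-≤ (s * k) (count-repeats≥ (palette ∘ suc) (palette-injective ∘ suc) U r)) ⟩
  k * (2 ^ s * (s * s ^ r) * k ^ n) + s * k * (2 ^ s * s ^ r * k ^ n)
    ≡⟨ solve 5 (λ k t s P K → k :* (t :* (s :* P) :* K) :+ s :* k :* (t :* P :* K)
                              := (con 2 :* t) :* (s :* P) :* (k :* K)) refl k (2 ^ s) s (s ^ r) (k ^ n) ⟩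
  2 * 2 ^ s * (s * s ^ r) * (k * k ^ n)
    ≤⟨ *-monoˡ-≤ (k * k ^ n) (*-monoʳ-≤ (2 * 2 ^ s) (^-monoˡ-≤ (suc r) (n≤1+n s))) ⟩
  2 ^ suc s * suc s ^ suc r * k ^ suc n
    ∎
  where
  open ≤-Reasoning
  s = ∣ U ∣
  A = count (λ ω → 𝟙 (suc r ≤? repeats (valuesOn U (colouring (palette ∘ suc) ω))))
  B = count (λ ω → 𝟙 (r ≤? repeats (valuesOn U (colouring (palette ∘ suc) ω))))

s≤⌈s/2⌉+⌈s/2⌉ : ∀ s → s ≤ ⌈ s /2⌉ + ⌈ s /2⌉
s≤⌈s/2⌉+⌈s/2⌉ s = subst (_≤ ⌈ s /2⌉ + ⌈ s /2⌉) (⌊n/2⌋+⌈n/2⌉≡n s) (+-monoˡ-≤ ⌈ s /2⌉ (⌊n/2⌋≤⌈n/2⌉ s))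

s≤2*r⇒⌈s/2⌉≤r : ∀ {s r} → s ≤ 2 * r → ⌈ s /2⌉ ≤ r
s≤2*r⇒⌈s/2⌉≤r {s} {r} s≤2r =
  subst (⌈ s /2⌉ ≤_) (sym (n≡⌈n+n/2⌉ r)) (⌈n/2⌉-mono (subst (s ≤_) (cong (r +_) (+-identityʳ r)) s≤2r))

^-distrib-* : ∀ a b n → (a * b) ^ n ≡ a ^ n * b ^ n
^-distrib-* a b zero    = refl
^-distrib-* a b (suc n) = begin
  a * b * (a * b) ^ n     ≡⟨ cong (a * b *_) (^-distrib-* a b n) ⟩
  a * b * (a ^ n * b ^ n) ≡⟨ solve 4 (λ a b p q → a :* b :* (p :* q) := a :* p :* (b :* q)) refl a b (a ^ n) (b ^ n) ⟩
  a * a ^ n * (b * b ^ n) ∎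
  where open ≡-Reasoning

4Γ2ˢsʳ≤kʳ : ∀ Γ s k → 16 * Γ ≤ 2 ^ s → 16 * s ≤ k → 4 * Γ * 2 ^ s * s ^ ⌈ s /2⌉ ≤ k ^ ⌈ s /2⌉
4Γ2ˢsʳ≤kʳ Γ s k 16Γ≤2ˢ 16s≤k = begin
  4 * Γ * 2 ^ s * s ^ r   ≤⟨ *-monoˡ-≤ (s ^ r) (*-monoˡ-≤ (2 ^ s) (*-monoˡ-≤ Γ (m≤m+n 4 12))) ⟩
  16 * Γ * 2 ^ s * s ^ r  ≤⟨ *-monoˡ-≤ (s ^ r) (*-monoˡ-≤ (2 ^ s) 16Γ≤2ˢ) ⟩
  2 ^ s * 2 ^ s * s ^ r   ≡⟨ cong (_* s ^ r) (^-distribˡ-+-* 2 s s) ⟨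
  2 ^ (s + s) * s ^ r     ≤⟨ *-monoˡ-≤ (s ^ r) (^-monoʳ-≤ 2 s+s≤4r) ⟩
  2 ^ (4 * r) * s ^ r     ≡⟨ cong (_* s ^ r) (^-*-assoc 2 4 r) ⟨
  16 ^ r * s ^ r          ≡⟨ ^-distrib-* 16 s r ⟨
  (16 * s) ^ r            ≤⟨ ^-monoˡ-≤ r 16s≤k ⟩
  k ^ r                   ∎
  where
  open ≤-Reasoning
  r = ⌈ s /2⌉
  s+s≤4r : s + s ≤ 4 * r
  s+s≤4r = ≤-trans (+-mono-≤ (s≤⌈s/2⌉+⌈s/2⌉ s) (s≤⌈s/2⌉+⌈s/2⌉ s))
                   (≤-reflexive (solve 1 (λ r → r :+ r :+ (r :+ r) := con 4 :* r) refl r))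

count-allRepeated-bound : (palette : Fin n → Fin k → ℕ) → (∀ v → Injective _≡_ _≡_ (palette v)) →
                          ∀ Γ U → .{{NonZero k}} → 16 * Γ ≤ 2 ^ ∣ U ∣ → 16 * ∣ U ∣ ≤ k →
                          4 * Γ * count (λ ω → 𝟙 (allRepeated? (valuesOn U (colouring palette ω)))) ≤ k ^ n
count-allRepeated-bound {n} {k} palette palette-injective Γ U 16Γ≤2ˢ 16s≤k =
  *-cancelʳ-≤ _ _ (k ^ r) {{m^n≢0 k r}} (begin
    4 * Γ * C * k ^ r                ≡⟨ *-assoc (4 * Γ) C (k ^ r) ⟩
    4 * Γ * (C * k ^ r)              ≤⟨ *-monoʳ-≤ (4 * Γ) (*-monoˡ-≤ (k ^ r) C≤Cᵣ) ⟩
    4 * Γ * (Cᵣ * k ^ r)             ≤⟨ *-monoʳ-≤ (4 * Γ) (count-repeats≥ palette palette-injective U r) ⟩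
    4 * Γ * (2 ^ s * s ^ r * k ^ n)  ≡⟨ solve 4 (λ g t p K → con 4 :* g :* (t :* p :* K) := con 4 :* g :* t :* p :* K)
                                                refl Γ (2 ^ s) (s ^ r) (k ^ n) ⟩
    4 * Γ * 2 ^ s * s ^ r * k ^ n    ≤⟨ *-monoˡ-≤ (k ^ n) (4Γ2ˢsʳ≤kʳ Γ s k 16Γ≤2ˢ 16s≤k) ⟩
    k ^ r * k ^ n                    ≡⟨ *-comm (k ^ r) (k ^ n) ⟩
    k ^ n * k ^ r                    ∎)
  where
  open ≤-Reasoning
  s = ∣ U ∣
  r = ⌈ s /2⌉
  xs : Vec (Fin k) n → List ℕ
  xs ω = valuesOn U (colouring palette ω)
  C Cᵣ : ℕ
  C = count (λ ω → 𝟙 (allRepeated? (xs ω)))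
  Cᵣ = count (λ ω → 𝟙 (r ≤? repeats (xs ω)))
  C≤Cᵣ : C ≤ Cᵣ
  C≤Cᵣ = count-mono-≤ λ ω → 𝟙-mono (allRepeated? (xs ω)) (r ≤? repeats (xs ω)) λ rep →
    s≤2*r⇒⌈s/2⌉≤r (subst (_≤ 2 * repeats (xs ω)) (length-valuesOn U _) (length≤2*repeats _ (xs ω) ≤-refl rep))

-- Exponential estimates

rising : ℕ → ℕ → ℕ
rising x zero    = 1
rising x (suc j) = rising x j * (x + j)

-- risingSeries c x N / (c ^ N * N !) = ∑_{j ≤ N} C(x + j - 1, j) / c ^ j, a partial sum of
-- (1 - 1/c) ^ -x; it dominates expNum c x N / (c ^ N * N !) termwise since x ^ j ≤ rising x j.
risingSeries : ℕ → ℕ → ℕ → ℕ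
risingSeries c x zero    = 1
risingSeries c x (suc N) = c * suc N * risingSeries c x N + rising x (suc N)

^≤rising : ∀ x j → x ^ j ≤ rising x j
^≤rising x zero    = ≤-refl
^≤rising x (suc j) = subst (_≤ rising x j * (x + j)) (*-comm (x ^ j) x) (*-mono-≤ (^≤rising x j) (m≤m+n x j))

expNum≤risingSeries : ∀ c x N → expNum c x N ≤ risingSeries c x N
expNum≤risingSeries c x zero    = ≤-refl
expNum≤risingSeries c x (suc N) =
  +-mono-≤ (*-monoʳ-≤ (c * suc N) (expNum≤risingSeries c x N)) (^≤rising x (suc N))

rising-suc : ∀ x N → rising x (suc N) ≡ x * rising (suc x) N
rising-suc x zero    = trans (cong (1 *_) (+-identityʳ x)) (trans (*-identityˡ x) (sym (*-identityʳ x)))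
rising-suc x (suc N) = begin
  rising x (suc N) * (x + suc N)        ≡⟨ cong₂ _*_ (rising-suc x N) (+-suc x N) ⟩
  x * rising (suc x) N * suc (x + N)    ≡⟨ *-assoc x _ _ ⟩
  x * (rising (suc x) N * suc (x + N))  ∎
  where open ≡-Reasoning

rising-pascal : ∀ x N → rising (suc x) (suc N) ≡ rising x (suc N) + suc N * rising (suc x) N
rising-pascal x N rewrite rising-suc x N =
  solve 3 (λ r x N → r :* (con 1 :+ x :+ N) := x :* r :+ (con 1 :+ N) :* r) refl (rising (suc x) N) x N

risingSeries-pascal : ∀ c x N →
  risingSeries c (suc x) (suc N) ≡ risingSeries c x (suc N) + suc N * risingSeries c (suc x) N
risingSeries-pascal c x zero rewrite rising-pascal x zero =
  solve 3 (λ c r a → c :* con 1 :* con 1 :+ (r :+ con 1 :* a) := c :* con 1 :* con 1 :+ r :+ con 1 :* a)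
          refl c (rising x 1) (rising (suc x) 0)
risingSeries-pascal c x (suc N) = begin
  c * (2 + N) * risingSeries c (suc x) (suc N) + rising (suc x) (2 + N)
    ≡⟨ cong₂ (λ a b → c * (2 + N) * a + b) (risingSeries-pascal c x N) (rising-pascal x (suc N)) ⟩
  c * (2 + N) * (S₀ + suc N * S₁) + (rising x (2 + N) + (2 + N) * rising (suc x) (suc N))
    ≡⟨ solve 6 (λ c N S₀ S₁ ra rb → c :* (con 2 :+ N) :* (S₀ :+ (con 1 :+ N) :* S₁) :+ (ra :+ (con 2 :+ N) :* rb)
                                   := c :* (con 2 :+ N) :* S₀ :+ ra :+ (con 2 :+ N) :* (c :* (con 1 :+ N) :* S₁ :+ rb))
               refl c N S₀ S₁ (rising x (2 + N)) (rising (suc x) (suc N)) ⟩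
  risingSeries c x (2 + N) + (2 + N) * risingSeries c (suc x) (suc N)
    ∎
  where
  open ≡-Reasoning
  S₀ = risingSeries c x (suc N)
  S₁ = risingSeries c (suc x) N

risingSeries-suc-≤ : ∀ c x N → c * risingSeries (suc c) (suc x) N ≤ suc c * risingSeries (suc c) x N
risingSeries-suc-≤ c x zero    = subst₂ _≤_ (sym (*-identityʳ c)) (sym (*-identityʳ (suc c))) (n≤1+n c)
risingSeries-suc-≤ c x (suc N) = +-cancelˡ-≤ S₁ _ _ (begin
  S₁ + c * S₁                          ≡⟨ cong (suc c *_) (risingSeries-pascal (suc c) x N) ⟩
  suc c * (S₀ + suc N * S)             ≡⟨ solve 4 (λ c S₀ N S → c :* (S₀ :+ N :* S) := c :* S₀ :+ c :* N :* S)
                                                  refl (suc c) S₀ (suc N) S ⟩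
  suc c * S₀ + suc c * suc N * S       ≤⟨ +-monoʳ-≤ (suc c * S₀) (m≤m+n _ _) ⟩
  suc c * S₀ + S₁                      ≡⟨ +-comm (suc c * S₀) S₁ ⟩
  S₁ + suc c * S₀                      ∎)
  where
  open ≤-Reasoning
  S S₀ S₁ : ℕ
  S = risingSeries (suc c) (suc x) N
  S₀ = risingSeries (suc c) x (suc N)
  S₁ = risingSeries (suc c) (suc x) (suc N)

risingSeries-zero : ∀ c N → risingSeries c 0 N ≡ c ^ N * N !
risingSeries-zero c zero    = refl
risingSeries-zero c (suc N) rewrite rising-suc 0 N | risingSeries-zero c N =
  solve 4 (λ c N P F → c :* (con 1 :+ N) :* (P :* F) :+ con 0 := c :* P :* ((con 1 :+ N) :* F)) refl c N (c ^ N) (N !)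

risingSeries-bound : ∀ c x N → risingSeries (suc c) x N * c ^ x ≤ suc c ^ x * (suc c ^ N * N !)
risingSeries-bound c zero    N =
  ≤-reflexive (trans (*-identityʳ _) (trans (risingSeries-zero (suc c) N) (sym (+-identityʳ _))))
risingSeries-bound c (suc x) N = begin
  risingSeries (suc c) (suc x) N * (c * c ^ x)  ≡⟨ solve 3 (λ a b d → a :* (b :* d) := b :* a :* d)
                                                           refl (risingSeries (suc c) (suc x) N) c (c ^ x) ⟩
  c * risingSeries (suc c) (suc x) N * c ^ x    ≤⟨ *-monoˡ-≤ (c ^ x) (risingSeries-suc-≤ c x N) ⟩
  suc c * risingSeries (suc c) x N * c ^ x      ≡⟨ *-assoc (suc c) (risingSeries (suc c) x N) (c ^ x) ⟩
  suc c * (risingSeries (suc c) x N * c ^ x)    ≤⟨ *-monoʳ-≤ (suc c) (risingSeries-bound c x N) ⟩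
  suc c * (suc c ^ x * (suc c ^ N * N !))       ≡⟨ *-assoc (suc c) (suc c ^ x) (suc c ^ N * N !) ⟨
  suc c ^ suc x * (suc c ^ N * N !)             ∎
  where open ≤-Reasoning

CLnLe⇒≤2^ : ∀ c′ y x → CLnLe (2 + c′) y x → y ≤ 2 ^ x
CLnLe⇒≤2^ c′ y x (N , y*F≤expNum) =
  *-cancelʳ-≤ y (2 ^ x) (c ^ x) {{m^n≢0 c x}} (*-cancelʳ-≤ _ _ F {{F≢0}} (begin
    y * c ^ x * F                     ≡⟨ solve 3 (λ y p f → y :* p :* f := y :* f :* p) refl y (c ^ x) F ⟩
    y * F * c ^ x                     ≤⟨ *-monoˡ-≤ (c ^ x) (≤-trans y*F≤expNum (expNum≤risingSeries (suc c) x N)) ⟩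
    risingSeries (suc c) x N * c ^ x  ≤⟨ risingSeries-bound c x N ⟩
    suc c ^ x * F                     ≤⟨ *-monoˡ-≤ F (^-monoˡ-≤ x (+-mono-≤ (s≤s z≤n) (m≤m+n c 0))) ⟩
    (2 * c) ^ x * F                   ≡⟨ cong (_* F) (^-distrib-* 2 c x) ⟩
    2 ^ x * c ^ x * F                 ∎))
  where
  open ≤-Reasoning
  c = suc c′
  F = suc c ^ N * N !
  F≢0 : NonZero F
  F≢0 = m*n≢0 (suc c ^ N) (N !) {{m^n≢0 (suc c) N}} {{N !≢0}}

lookup-injective : ∀ {A : Set} {xs : List A} → Unique xs → Injective _≡_ _≡_ (lookupₗ xs)
lookup-injective {xs = x ∷ xs} (x∉xs ∷ _) {zero}  {zero}  _     = refl
lookup-injective {xs = x ∷ xs} (x∉xs ∷ _) {zero}  {suc j} x≡xsⱼ = contradiction x≡xsⱼ (All.lookup x∉xs (∈-lookup j))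
lookup-injective {xs = x ∷ xs} (x∉xs ∷ _) {suc i} {zero}  xsᵢ≡x = contradiction (sym xsᵢ≡x) (All.lookup x∉xs (∈-lookup i))
lookup-injective {xs = x ∷ xs} (_ ∷ xs-unique) {suc i} {suc j} xsᵢ≡xsⱼ =
  cong suc (lookup-injective xs-unique xsᵢ≡xsⱼ)

cast-injective : ∀ {m n} .(eq : m ≡ n) → Injective _≡_ _≡_ (cast eq)
cast-injective eq {i} {j} castᵢ≡castⱼ = Fin.toℕ-injective (begin
  toℕ i           ≡⟨ Fin.toℕ-cast eq i ⟨
  toℕ (cast eq i) ≡⟨ cong toℕ castᵢ≡castⱼ ⟩
  toℕ (cast eq j) ≡⟨ Fin.toℕ-cast eq j ⟩
  toℕ j           ∎)
  where open ≡-Reasoning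

module _ (H : Hypergraph n m) where

  nonadjacent-disjoint : ∀ {i j} → j ≢ i → j ∉ neighbours H i → Empty (edge H i ∩ edge H j)
  nonadjacent-disjoint {i} {j} j≢i j∉N meet =
    j∉N (lookup⇒[]= j (neighbours H i) (trans (lookup∘tabulate _ j) adjacent))
    where
    adjacent : (if does (j Fin.≟ i) then false else meets (edge H i) (edge H j)) ≡ true
    adjacent with j Fin.≟ i | nonempty? (edge H i ∩ edge H j)
    ... | yes j≡i | _        = contradiction j≡i j≢i
    ... | no  _   | yes _    = refl
    ... | no  _   | no ¬meet = contradiction meet ¬meet

  module _ (L : Assignment n k) where

    palette : Fin n → Fin k → ℕ
    palette v c = lookupₗ (list L v) (cast (sym (size L v)) c)

    palette-injective : ∀ v → Injective _≡_ _≡_ (palette v)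
    palette-injective v = cast-injective (sym (size L v)) ∘ lookup-injective (unique L v)

    NoUniqueColour : Fin m → Vec (Fin k) n → Set
    NoUniqueColour e ω = AllRepeated (valuesOn (edge H e) (colouring palette ω))

    noUniqueColour? : ∀ e ω → Dec (NoUniqueColour e ω)
    noUniqueColour? e ω = allRepeated? (valuesOn (edge H e) (colouring palette ω))

    unique-colour : ∀ e ω → ¬ NoUniqueColour e ω →
                    ∃ λ v → v ∈ edge H e × (∀ w → w ∈ edge H e → w ≢ v → colouring palette ω w ≢ colouring palette ω v)
    unique-colour e ω ¬rep =
      let z , z∈xs , ¬2≤z = find (¬All⇒Any¬ (λ z → 2 ≤? multiplicity z xs) xs ¬rep)
          v , v∈e , fv≡z  = ∈-valuesOn⁻ (edge H e) f z∈xs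
      in v , v∈e , λ w w∈e w≢v fw≡fv →
           ¬2≤z (subst (λ z → 2 ≤ multiplicity z xs) fv≡z
                       (multiplicity-valuesOn≥2 (edge H e) f (w≢v ∘ sym) v∈e w∈e (sym fw≡fv)))
      where
      f = colouring palette ω
      xs = valuesOn (edge H e) f

cf-choosable : (H : Hypergraph n m) (Γ k : ℕ) .{{_ : NonZero Γ}} .{{_ : NonZero k}} →
               (∀ e → degree H e ≤ Γ) → (∀ e → 16 * Γ ≤ 2 ^ ∣ edge H e ∣) → (∀ e → 16 * ∣ edge H e ∣ ≤ k) →
               CFChoosable H k
cf-choosable {n} H Γ k deg≤Γ 16Γ≤2ˢ 16s≤k L =
  let ω , good = lovász-local-lemma (NoUniqueColour H L) (noUniqueColour? H L) (edge H) supported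
                                    Γ (neighbours H) deg≤Γ (nonadjacent-disjoint H) rare
  in colouring (palette H L) ω , (λ v → ∈-lookup _) , λ e → unique-colour H L e ω (good e)
  where
  supported : ∀ e {ω ω′} → Agree (edge H e) ω ω′ → NoUniqueColour H L e ω → NoUniqueColour H L e ω′
  supported e agr = subst AllRepeated (valuesOn-cong (edge H e) λ {v} v∈e → cong (palette H L v) (agr v v∈e))
  rare : ∀ e → 4 * Γ * Events.#bad (NoUniqueColour H L) (noUniqueColour? H L) e ≤ k ^ n
  rare e = count-allRepeated-bound (palette H L) (palette-injective H L) Γ (edge H e) (16Γ≤2ˢ e) (16s≤k e)

lemma3 : (Γ β : ℕ) → 1 ≤ Γ → 1 ≤ β → (n m : ℕ) → (H : Hypergraph n m) → (∀ e → degree H e ≤ Γ) → (∀ e → AlphaLe Γ (∣ edge H e ∣) × (∣ edge H e ∣ ≤ β)) → chCF≤ H (32 * β)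
lemma3 Γ β Γ≥1 β≥1 n m H deg≤Γ size-bounds =
  32 * β , ≤-refl , cf-choosable H Γ (32 * β) {{>-nonZero Γ≥1}} {{m*n≢0 32 β {{_}} {{>-nonZero β≥1}}}} deg≤Γ
    (λ e → CLnLe⇒≤2^ 134 (16 * Γ) ∣ edge H e ∣ (proj₂ (proj₁ (size-bounds e))))
    (λ e → *-mono-≤ (m≤m+n 16 16) (proj₂ (size-bounds e)))
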